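{- Let $\langle w\rangle$ be a square-free circular word of length at least $2$ over the alphabet $\{\mathtt{0},\mathtt{1},\mathtt{2}\}$, and let $W\in h(w)$. Then the circular word $\langle W\rangle$ is square-free and walkable in the digraph $D$.
   Context: Let $\mathbb{S}_\Gamma$ be the six permutations of $\{\mathtt{a},\mathtt{b},\mathtt{c}\}$ written in cycle notation as formal symbols $()$, $(\mathtt{ab})$, $(\mathtt{ac})$, $(\mathtt{bc})$, $(\mathtt{abc})$, $(\mathtt{acb})$, and for each such $\pi$ let $\tilde\pi$ be another formal symbol; $\widetilde{\mathbb{S}}_\Gamma=\{\tilde\pi\}$. The digraph $D$ has vertex set $V(D)=\mathbb{S}_\Gamma\cup\widetilde{\mathbb{S}}_\Gamma$ (12 vertices) and exactly the 24 arcs: $()\to\widetilde{(\mathtt{ab})}$, $()\to(\mathtt{bc})$; $(\mathtt{ab})\to\widetilde{()}$, $(\mathtt{ab})\to(\mathtt{abc})$; $(\mathtt{ac})\to\widetilde{(\mathtt{abc})}$, $(\mathtt{ac})\to(\mathtt{acb})$; $(\mathtt{bc})\to\widetilde{(\mathtt{acb})}$, $(\mathtt{bc})\to()$; $(\mathtt{abc})\to\widetilde{(\mathtt{ac})}$, $(\mathtt{abc})\to(\mathtt{ab})$; $(\mathtt{acb})\to\widetilde{(\mathtt{bc})}$, $(\mathtt{acb})\to(\mathtt{ac})$; $\widetilde{()}\to(\mathtt{ac})$, $\widetilde{()}\to\widetilde{(\mathtt{bc})}$; $\widetilde{(\mathtt{ab})}\to(\mathtt{acb})$, $\widetilde{(\mathtt{ab})}\to\widetilde{(\mathtt{abc})}$;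 $\widetilde{(\mathtt{ac})}\to()$, $\widetilde{(\mathtt{ac})}\to\widetilde{(\mathtt{acb})}$; $\widetilde{(\mathtt{bc})}\to(\mathtt{abc})$, $\widetilde{(\mathtt{bc})}\to\widetilde{()}$; $\widetilde{(\mathtt{abc})}\to(\mathtt{bc})$, $\widetilde{(\mathtt{abc})}\to\widetilde{(\mathtt{ab})}$; $\widetilde{(\mathtt{acb})}\to(\mathtt{ab})$, $\widetilde{(\mathtt{acb})}\to\widetilde{(\mathtt{ac})}$. The substitution $h:\{\mathtt{0},\mathtt{1},\mathtt{2}\}^*\to 2^{V(D)^*}$ is given on letters by $h(\mathtt{0})=\{()\widetilde{(\mathtt{ab})}(\mathtt{acb})(\mathtt{ac})\widetilde{(\mathtt{abc})}(\mathtt{bc})\}$, $h(\mathtt{1})=\{()\widetilde{(\mathtt{ab})}\widetilde{(\mathtt{abc})}(\mathtt{bc})\widetilde{(\mathtt{acb})}\widetilde{(\mathtt{ac})}\}$, $h(\mathtt{2})=\{()\widetilde{(\mathtt{ab})}(\mathtt{acb})\widetilde{(\mathtt{bc})}(\mathtt{abc})\widetilde{(\mathtt{ac})},\ ()\widetilde{(\mathtt{ab})}(\mathtt{acb})\widetilde{(\mathtt{bc})}(\mathtt{abc})(\mathtt{ab})(\mathtt{abc})\widetilde{(\mathtt{ac})}\}$, (each symbol being a single letter of $V(D)$), and on words by $h(a_1\cdots a_n)=\{A_1\cdots A_n:A_i\in h(a_i)\}$. A word is square-free if it has no factor $xx$ with $x$ nonempty. The circular word $\langle w\rangle$ is the set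 of all conjugates (cyclic shifts) of $w$; it is square-free if every conjugate is square-free; its length is $|w|$. For $W=w_0w_1\cdots w_{n-1}$ over $V(D)$, $\langle W\rangle$ is walkable in $D$ if there is an arc from $w_i$ to $w_{i+1}$ for every $i\in\{0,\dots,n-1\}$, indices modulo $n$. -}

module Defs where

open import Data.Nat using (ℕ; suc; _≤_; _%_)
open import Data.Nat.DivMod using (m%n<n)
open import Data.List using (List; []; _∷_; _++_; take; drop; length; lookup)
open import Data.List.Membership.Propositional using (_∈_)
open import Data.Fin using (Fin; toℕ; fromℕ<)
open import Data.Product using (Σ; ∃; _×_; _,_)
open import Relation.Binary.PropositionalEquality using (_≡_)
open import Relation.Nullary using (¬_)

data Σ₃ : Set where
  𝟘 𝟙 𝟚 : Σ₃

-- Vertices of D: the six permutations π (names are formal symbols)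
-- and their tilded copies π̃.
data Perm : Set where
  e ab ac bc abc acb : Perm

data V : Set where
  plain : Perm → V
  tilde : Perm → V

data Arc : V → V → Set where
  a01 : Arc (plain e)   (tilde ab)
  a02 : Arc (plain e)   (plain bc)
  a03 : Arc (plain ab)  (tilde e)
  a04 : Arc (plain ab)  (plain abc)
  a05 : Arc (plain ac)  (tilde abc)
  a06 : Arc (plain ac)  (plain acb)
  a07 : Arc (plain bc)  (tilde acb)
  a08 : Arc (plain bc)  (plain e)
  a09 : Arc (plain abc) (tilde ac)
  a10 : Arc (plain abc) (plain ab)
  a11 : Arc (plain acb) (tilde bc)
  a12 : Arc (plain acb) (plain ac)
  a13 : Arc (tilde e)   (plain ac)
  a14 : Arc (tilde e)   (tilde bc)
  a15 : Arc (tilde ab)  (plain acb)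
  a16 : Arc (tilde ab)  (tilde abc)
  a17 : Arc (tilde ac)  (plain e)
  a18 : Arc (tilde ac)  (tilde acb)
  a19 : Arc (tilde bc)  (plain abc)
  a20 : Arc (tilde bc)  (tilde e)
  a21 : Arc (tilde abc) (plain bc)
  a22 : Arc (tilde abc) (tilde ab)
  a23 : Arc (tilde acb) (plain ab)
  a24 : Arc (tilde acb) (tilde ac)

h : Σ₃ → List (List V)
h 𝟘 = (plain e ∷ tilde ab ∷ plain acb ∷ plain ac ∷ tilde abc ∷ plain bc ∷ []) ∷ []
h 𝟙 = (plain e ∷ tilde ab ∷ tilde abc ∷ plain bc ∷ tilde acb ∷ tilde ac ∷ []) ∷ []
h 𝟚 = (plain e ∷ tilde ab ∷ plain acb ∷ tilde bc ∷ plain abc ∷ tilde ac ∷ [])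
    ∷ (plain e ∷ tilde ab ∷ plain acb ∷ tilde bc ∷ plain abc ∷ plain ab ∷ plain abc ∷ tilde ac ∷ [])
    ∷ []

data InH : List Σ₃ → List V → Set where
  []  : InH [] []
  _∷_ : ∀ {a w A W} → A ∈ h a → InH w W → InH (a ∷ w) (A ++ W)

SquareFree : {A : Set} → List A → Set
SquareFree {A} w = ∀ (u x v : List A) → ¬ (x ≡ []) → ¬ (u ++ x ++ x ++ v ≡ w)

rotate : {A : Set} → ℕ → List A → List A
rotate i w = drop i w ++ take i w

CircSquareFree : {A : Set} → List A → Set
CircSquareFree w = ∀ (i : ℕ) → i ≤ length w → SquareFree (rotate i w)

next : {A : Set} (w : List A) → Fin (length w) → Fin (length w)
next (x ∷ xs) i = fromℕ< (m%n<n (suc (toℕ i)) (suc (length xs)))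

Walkable : List V → Set
Walkable W = ∀ (i : Fin (length W)) → Arc (lookup W i) (lookup W (next W i))

module Submission where

-- Every image h(a) is a "block" that begins with the marker () and contains
-- no other (). Hence the occurrences of () in W are exactly the block
-- boundaries, and the blocks form a prefix code, so W decodes uniquely.

open import Defs
open import Data.Bool using (Bool; true; false; not; _∧_; T)
open import Data.Bool.Properties using (T-∧; T-not-≡)
open import Data.Empty using (⊥; ⊥-elim)
open import Data.Fin using (Fin; zero; suc; toℕ; fromℕ<)
open import Data.Fin.Properties using (fromℕ<-cong; toℕ<n)
open import Data.List using (List; []; _∷_; _++_; [_]; _∷ʳ_; length; take; drop; reverse; lookup)
open import Data.List.Properties using (++-assoc; ++-identityʳ; ++-conicalˡ; ++-conicalʳ; ++-cancelˡ; ∷-injective; ∷-injectiveʳ; ∷ʳ-injective; ++-monoid; take++drop≡id; length-++-≤ˡ; reverse-++; reverse-involutive)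
open import Data.List.Membership.Propositional using (_∈_; _∉_)
open import Data.List.Membership.Propositional.Properties using (∈-++⁺ʳ; ∈-++⁻)
open import Data.List.Relation.Unary.Any using (here; there; any?)
open import Data.Nat using (ℕ; zero; suc; _+_; _≤_; _<_; z≤n; s≤s; _%_; _≡ᵇ_; _<?_)
open import Data.Nat.Properties using (≡⇒≡ᵇ; m≤n⇒m<n∨m≡n; suc-injective)
open import Data.Nat.DivMod using (m%n<n; m<n⇒m%n≡m; n%n≡0)
open import Data.Product using (∃; ∃₂; _×_; _,_; proj₁; proj₂)
open import Data.Sum using (_⊎_; inj₁; inj₂; [_,_]′)
open import Data.Unit using (⊤; tt)
open import Function using (_∘_)
open import Function.Bundles using (Equivalence)
open import Relation.Binary.PropositionalEquality using (_≡_; _≢_; refl; sym; trans; cong; cong₂; subst)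
open import Relation.Nullary using (Dec; yes; no)
open import Relation.Nullary.Decidable using (from-yes; from-no)
import Algebra.Solver.Monoid as MonoidSolver

module ++-Solver {A : Set} = MonoidSolver (++-monoid A)
open ++-Solver using (solve; _⊕_; _⊜_)

++-split : ∀ {A : Set} (p q r t : List A) → p ++ q ≡ r ++ t →
           (∃ λ z → p ≡ r ++ z × t ≡ z ++ q) ⊎ (∃ λ z → z ≢ [] × r ≡ p ++ z × q ≡ z ++ t)
++-split []      q []      t eq = inj₁ ([] , refl , sym eq)
++-split []      q (y ∷ r) t eq = inj₂ (y ∷ r , (λ ()) , refl , eq)
++-split (x ∷ p) q []      t eq = inj₁ (x ∷ p , refl , sym eq)
++-split (x ∷ p) q (y ∷ r) t eq with ∷-injective eq
... | refl , eq′ with ++-split p q r t eq′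
...   | inj₁ (z , p≡ , t≡)       = inj₁ (z , cong (x ∷_) p≡ , t≡)
...   | inj₂ (z , z≢[] , r≡ , q≡) = inj₂ (z , z≢[] , cong (x ∷_) r≡ , q≡)

take-length-++ : ∀ {A : Set} (x y : List A) → take (length x) (x ++ y) ≡ x
take-length-++ []      y = refl
take-length-++ (a ∷ x) y = cong (a ∷_) (take-length-++ x y)

drop-length-++ : ∀ {A : Set} (x y : List A) → drop (length x) (x ++ y) ≡ y
drop-length-++ []      y = refl
drop-length-++ (a ∷ x) y = drop-length-++ x y

rotate-++ : ∀ {A : Set} (p q : List A) → rotate (length p) (p ++ q) ≡ q ++ p
rotate-++ p q = cong₂ _++_ (drop-length-++ p q) (take-length-++ p q)

snoc-view : ∀ {A : Set} (x : List A) → x ≡ [] ⊎ ∃₂ λ x₀ l → x ≡ x₀ ∷ʳ l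
snoc-view []      = inj₁ refl
snoc-view (a ∷ x) with snoc-view x
... | inj₁ refl           = inj₂ ([] , a , refl)
... | inj₂ (x₀ , l , refl) = inj₂ (a ∷ x₀ , l , refl)

reverse-flip : ∀ {A : Set} {s L : List A} → reverse s ≡ L → s ≡ reverse L
reverse-flip {s = s} rs = trans (sym (reverse-involutive s)) (cong reverse rs)

∷ʳ≢[] : ∀ {A : Set} (x : List A) (a : A) → x ∷ʳ a ≢ []
∷ʳ≢[] []      a ()
∷ʳ≢[] (_ ∷ _) a ()

square-free-factor : ∀ {A : Set} {L : List A} → SquareFree L →
                     ∀ p m q → L ≡ p ++ m ++ q → SquareFree m
square-free-factor sf p m q refl u x v x≢[] eq =
  sf (p ++ u) x (v ++ q) x≢[] (trans regroup (cong (λ M → p ++ M ++ q) eq))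
  where
  regroup : (p ++ u) ++ x ++ x ++ (v ++ q) ≡ p ++ (u ++ x ++ x ++ v) ++ q
  regroup = solve 5 (λ p u x v q → (p ⊕ u) ⊕ x ⊕ x ⊕ (v ⊕ q) ⊜ p ⊕ (u ⊕ x ⊕ x ⊕ v) ⊕ q) refl p u x v q

square-free-glue : ∀ {A : Set} {a b : A} {M : List A} →
                   SquareFree (a ∷ M) → SquareFree (M ∷ʳ b) → (∀ x → x ++ x ≢ a ∷ M ∷ʳ b) →
                   SquareFree (a ∷ M ∷ʳ b)
square-free-glue sfˡ sfʳ not-square (_ ∷ u) x v x≢[] eq = sfʳ u x v x≢[] (∷-injectiveʳ eq)
square-free-glue {a = a} {b} {M} sfˡ sfʳ not-square [] x v x≢[] eq with snoc-view v
... | inj₁ refl = not-square x (trans (cong (x ++_) (sym (++-identityʳ x))) eq)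
... | inj₂ (v₀ , l , refl) =
  sfˡ [] x v₀ x≢[] (proj₁ (∷ʳ-injective (x ++ x ++ v₀) (a ∷ M) (trans regroup eq)))
  where
  regroup : (x ++ x ++ v₀) ∷ʳ l ≡ x ++ x ++ v₀ ∷ʳ l
  regroup = solve 3 (λ x v₀ l → (x ⊕ x ⊕ v₀) ⊕ l ⊜ x ⊕ x ⊕ (v₀ ⊕ l)) refl x v₀ [ l ]

-- A sound test for square-freeness over any type with a Boolean comparison;
-- soundness only needs x == x ≡ true. It certifies that the blocks are square-free.

module SquareFreeTest {A : Set} (_==_ : A → A → Bool) (==-refl : ∀ x → T (x == x)) where

  _≼_ : List A → List A → Bool
  []      ≼ L       = true
  (a ∷ x) ≼ []      = false
  (a ∷ x) ≼ (b ∷ L) = (a == b) ∧ (x ≼ L)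

  ≼-++ : ∀ x r → T (x ≼ (x ++ r))
  ≼-++ []      r = tt
  ≼-++ (a ∷ x) r = Equivalence.from T-∧ (==-refl a , ≼-++ x r)

  no-square-prefix : ℕ → List A → Bool
  no-square-prefix zero    L = true
  no-square-prefix (suc n) L = not (take (suc n) L ≼ drop (suc n) L) ∧ no-square-prefix n L

  no-square-prefix-sound : ∀ n x r → T (no-square-prefix n (x ++ x ++ r)) → x ≢ [] → length x ≤ n → ⊥
  no-square-prefix-sound zero    []      r ok x≢[] _  = x≢[] refl
  no-square-prefix-sound zero    (a ∷ x) r ok x≢[] ()
  no-square-prefix-sound (suc n) x       r ok x≢[] |x|≤ with Equivalence.to T-∧ ok | m≤n⇒m<n∨m≡n |x|≤
  ... | _         , rest | inj₁ (s≤s |x|≤n) = no-square-prefix-sound n x r rest x≢[] |x|≤n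
  ... | no-square , _    | inj₂ |x|≡        = subst T (Equivalence.to T-not-≡ aligned) (≼-++ x r)
    where
    L : List A
    L = x ++ x ++ r
    at-|x| : T (not (take (length x) L ≼ drop (length x) L))
    at-|x| = subst (λ k → T (not (take k L ≼ drop k L))) (sym |x|≡) no-square
    aligned : T (not (x ≼ (x ++ r)))
    aligned = subst T (cong₂ (λ p q → not (p ≼ q)) (take-length-++ x (x ++ r)) (drop-length-++ x (x ++ r))) at-|x|

  square-free? : List A → Bool
  square-free? []      = true
  square-free? (a ∷ L) = no-square-prefix (length (a ∷ L)) (a ∷ L) ∧ square-free? L

  square-free?-sound : ∀ L → T (square-free? L) → SquareFree L
  square-free?-sound L ok (b ∷ u) x v x≢[] refl =
    square-free?-sound _ (proj₂ (Equivalence.to T-∧ ok)) u x v x≢[] refl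
  square-free?-sound L ok [] [] v x≢[] eq = x≢[] refl
  square-free?-sound L ok [] x@(_ ∷ _) v x≢[] refl =
    no-square-prefix-sound _ x v (proj₁ (Equivalence.to T-∧ ok)) x≢[] (length-++-≤ˡ x)

is-marker? : (y : V) → Dec (plain e ≡ y)
is-marker? (plain e)   = yes refl
is-marker? (plain ab)  = no (λ ())
is-marker? (plain ac)  = no (λ ())
is-marker? (plain bc)  = no (λ ())
is-marker? (plain abc) = no (λ ())
is-marker? (plain acb) = no (λ ())
is-marker? (tilde _)   = no (λ ())

perm-index : Perm → ℕ
perm-index e   = 0
perm-index ab  = 1
perm-index ac  = 2
perm-index bc  = 3
perm-index abc = 4
perm-index acb = 5

vertex-index : V → ℕ
vertex-index (plain p) = perm-index p
vertex-index (tilde p) = 6 + perm-index p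

_==_ : V → V → Bool
x == y = vertex-index x ≡ᵇ vertex-index y

open SquareFreeTest _==_ (λ x → ≡⇒≡ᵇ (vertex-index x) (vertex-index x) refl) using (square-free?-sound)

block₀ block₁ block₂ block₂′ : List V
block₀  = plain e ∷ tilde ab ∷ plain acb ∷ plain ac ∷ tilde abc ∷ plain bc ∷ []
block₁  = plain e ∷ tilde ab ∷ tilde abc ∷ plain bc ∷ tilde acb ∷ tilde ac ∷ []
block₂  = plain e ∷ tilde ab ∷ plain acb ∷ tilde bc ∷ plain abc ∷ tilde ac ∷ []
block₂′ = plain e ∷ tilde ab ∷ plain acb ∷ tilde bc ∷ plain abc ∷ plain ab ∷ plain abc ∷ tilde ac ∷ []

data Block : Σ₃ → List V → Set where
  blk₀  : Block 𝟘 block₀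
  blk₁  : Block 𝟙 block₁
  blk₂  : Block 𝟚 block₂
  blk₂′ : Block 𝟚 block₂′

block-of : ∀ {a A} → A ∈ h a → Block a A
block-of {𝟘} (here refl)         = blk₀
block-of {𝟙} (here refl)         = blk₁
block-of {𝟚} (here refl)         = blk₂
block-of {𝟚} (there (here refl)) = blk₂′

block-shape : ∀ {a A} → Block a A → ∃ λ A′ → A ≡ plain e ∷ A′ × plain e ∉ A′
block-shape {A = A} blk₀  = drop 1 A , refl , from-no (any? is-marker? (drop 1 A))
block-shape {A = A} blk₁  = drop 1 A , refl , from-no (any? is-marker? (drop 1 A))
block-shape {A = A} blk₂  = drop 1 A , refl , from-no (any? is-marker? (drop 1 A))
block-shape {A = A} blk₂′ = drop 1 A , refl , from-no (any? is-marker? (drop 1 A))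

marker-only-first : ∀ {a A u s} → Block a A → A ≡ u ++ s → u ≢ [] → plain e ∉ s
marker-only-first {u = []}    bA A≡ u≢[] _   = u≢[] refl
marker-only-first {u = _ ∷ u} bA A≡ _    e∈s with block-shape bA
... | A′ , refl , e∉A′ = e∉A′ (subst (plain e ∈_) (sym (∷-injectiveʳ A≡)) (∈-++⁺ʳ u e∈s))

block-length : ∀ {a A} → Block a A → 5 < length A
block-length {A = A} blk₀  = from-yes (5 <? length A)
block-length {A = A} blk₁  = from-yes (5 <? length A)
block-length {A = A} blk₂  = from-yes (5 <? length A)
block-length {A = A} blk₂′ = from-yes (5 <? length A)

block-square-free : ∀ {a A} → Block a A → SquareFree A
block-square-free blk₀  = square-free?-sound _ tt
block-square-free blk₁  = square-free?-sound _ tt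
block-square-free blk₂  = square-free?-sound _ tt
block-square-free blk₂′ = square-free?-sound _ tt

block-prefix-code : ∀ {a b A B X Y} → Block a A → Block b B → A ++ X ≡ B ++ Y → a ≡ b × A ≡ B × X ≡ Y
block-prefix-code blk₀  blk₀  eq = refl , refl , ++-cancelˡ block₀ _ _ eq
block-prefix-code blk₁  blk₁  eq = refl , refl , ++-cancelˡ block₁ _ _ eq
block-prefix-code blk₂  blk₂  eq = refl , refl , ++-cancelˡ block₂ _ _ eq
block-prefix-code blk₂′ blk₂′ eq = refl , refl , ++-cancelˡ block₂′ _ _ eq
block-prefix-code blk₀  blk₁  ()
block-prefix-code blk₀  blk₂  ()
block-prefix-code blk₀  blk₂′ ()
block-prefix-code blk₁  blk₀  ()
block-prefix-code blk₁  blk₂  ()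
block-prefix-code blk₁  blk₂′ ()
block-prefix-code blk₂  blk₀  ()
block-prefix-code blk₂  blk₁  ()
block-prefix-code blk₂  blk₂′ ()
block-prefix-code blk₂′ blk₀  ()
block-prefix-code blk₂′ blk₁  ()
block-prefix-code blk₂′ blk₂  ()

last-two-determine : ∀ {a c A C y₁ y₂ R₁ R₂} → Block a A → Block c C →
                     reverse A ≡ y₁ ∷ y₂ ∷ R₁ → reverse C ≡ y₁ ∷ y₂ ∷ R₂ → a ≡ c
last-two-determine blk₀  blk₀  _    _  = refl
last-two-determine blk₁  blk₁  _    _  = refl
last-two-determine blk₂  blk₂  _    _  = refl
last-two-determine blk₂  blk₂′ _    _  = refl
last-two-determine blk₂′ blk₂  _    _  = refl
last-two-determine blk₂′ blk₂′ _    _  = refl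
last-two-determine blk₀  blk₁  refl ()
last-two-determine blk₀  blk₂  refl ()
last-two-determine blk₀  blk₂′ refl ()
last-two-determine blk₁  blk₀  refl ()
last-two-determine blk₁  blk₂  refl ()
last-two-determine blk₁  blk₂′ refl ()
last-two-determine blk₂  blk₀  refl ()
last-two-determine blk₂  blk₁  refl ()
last-two-determine blk₂′ blk₀  refl ()
last-two-determine blk₂′ blk₁  refl ()

first-four-determine : ∀ {c d C D T y₁ y₂ y₃ y₄ R₁ R₂} → Block c C → Block d D →
                       C ≡ y₁ ∷ y₂ ∷ y₃ ∷ y₄ ∷ R₁ → D ++ T ≡ y₁ ∷ y₂ ∷ y₃ ∷ y₄ ∷ R₂ → c ≡ d
first-four-determine blk₀  blk₀  _    _  = refl
first-four-determine blk₁  blk₁  _    _  = refl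
first-four-determine blk₂  blk₂  _    _  = refl
first-four-determine blk₂  blk₂′ _    _  = refl
first-four-determine blk₂′ blk₂  _    _  = refl
first-four-determine blk₂′ blk₂′ _    _  = refl
first-four-determine blk₀  blk₁  refl ()
first-four-determine blk₀  blk₂  refl ()
first-four-determine blk₀  blk₂′ refl ()
first-four-determine blk₁  blk₀  refl ()
first-four-determine blk₁  blk₂  refl ()
first-four-determine blk₁  blk₂′ refl ()
first-four-determine blk₂  blk₀  refl ()
first-four-determine blk₂  blk₁  refl ()
first-four-determine blk₂′ blk₀  refl ()
first-four-determine blk₂′ blk₁  refl ()

four-letter-prefix : ∀ {A : Set} (C₁ : List A) (q : A) → 5 < length (C₁ ∷ʳ q) →
                     ∃ λ y₁ → ∃ λ y₂ → ∃ λ y₃ → ∃ λ y₄ → ∃ λ R → C₁ ≡ y₁ ∷ y₂ ∷ y₃ ∷ y₄ ∷ R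
four-letter-prefix (y₁ ∷ y₂ ∷ y₃ ∷ y₄ ∷ R) q _ = y₁ , y₂ , y₃ , y₄ , R , refl
four-letter-prefix []                     q (s≤s ())
four-letter-prefix (_ ∷ [])               q (s≤s (s≤s ()))
four-letter-prefix (_ ∷ _ ∷ [])           q (s≤s (s≤s (s≤s ())))
four-letter-prefix (_ ∷ _ ∷ _ ∷ [])       q (s≤s (s≤s (s≤s (s≤s ()))))

-- A common one-letter suffix of C = C₁ q leaves four letters of C₁ that
-- also begin the block D.
one-letter-suffix : ∀ {c d C D C₁ q v T} → Block c C → Block d D →
                    C ≡ C₁ ∷ʳ q → D ++ T ≡ C₁ ++ v → c ≡ d
one-letter-suffix {C₁ = C₁} {q} bC bD C≡ D≡
  with four-letter-prefix C₁ q (subst (λ L → 5 < length L) C≡ (block-length bC))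
... | y₁ , y₂ , y₃ , y₄ , R , refl = first-four-determine bC bD C≡ D≡

synchronise : ∀ {a c d A C D A₁ C₁ s v T} → Block a A → Block c C → Block d D →
              A ≡ A₁ ++ s → C ≡ C₁ ++ s → D ++ T ≡ C₁ ++ v → s ≢ [] → a ≡ c ⊎ c ≡ d
synchronise {A₁ = A₁} {C₁} {s} bA bC bD A≡ C≡ D≡ s≢[] with reverse s in rs
... | []          = ⊥-elim (s≢[] (reverse-flip rs))
... | q ∷ []      = inj₂ (one-letter-suffix bC bD (trans C≡ (cong (C₁ ++_) (reverse-flip rs))) D≡)
... | y₁ ∷ y₂ ∷ R = inj₁ (last-two-determine bA bC (reversed A₁ A≡) (reversed C₁ C≡))
  where
  reversed : ∀ {B} X → B ≡ X ++ s → reverse B ≡ y₁ ∷ y₂ ∷ (R ++ reverse X)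
  reversed X refl = trans (reverse-++ X s) (cong (_++ reverse X) rs)

InH-++ : ∀ {w₁ w₂ W₁ W₂} → InH w₁ W₁ → InH w₂ W₂ → InH (w₁ ++ w₂) (W₁ ++ W₂)
InH-++ []                          i₂ = i₂
InH-++ (_∷_ {A = A} {W = W} pA i₁) i₂ = subst (InH _) (sym (++-assoc A W _)) (pA ∷ InH-++ i₁ i₂)

InH-single : ∀ {a A} → A ∈ h a → InH [ a ] A
InH-single {A = A} pA = subst (InH _) (++-identityʳ A) (pA ∷ [])

image-shape : ∀ {w W} → InH w W → (w ≡ [] × W ≡ []) ⊎ ∃ λ W′ → W ≡ plain e ∷ W′
image-shape []                  = inj₁ (refl , refl)
image-shape (_∷_ {W = W} pA iW) with block-shape (block-of pA)
... | A′ , refl , _ = inj₂ (A′ ++ W , refl)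

image-empty : ∀ {w} → InH w [] → w ≡ []
image-empty iW with image-shape iW
... | inj₁ (w≡[] , _) = w≡[]
... | inj₂ (_ , ())

image-begins : ∀ {w W y W′} → InH w W → W ≡ y ∷ W′ → y ≡ plain e
image-begins iW W≡ with image-shape iW
... | inj₁ (_ , refl)  = ⊥-elim (nonempty W≡)
  where
  nonempty : ∀ {y : V} {W′} → [] ≢ y ∷ W′
  nonempty ()
... | inj₂ (_ , refl) = sym (proj₁ (∷-injective W≡))

first-block : ∀ {w W} → InH w W → W ≢ [] →
              ∃ λ d → ∃ λ w′ → ∃ λ D → ∃ λ W′ → w ≡ d ∷ w′ × D ∈ h d × W ≡ D ++ W′
first-block []       W≢[] = ⊥-elim (W≢[] refl)
first-block (pD ∷ _) _    = _ , _ , _ , _ , refl , pD , refl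

prefix-decode : ∀ {w₁ w₂ X Y} → InH w₁ X → InH w₂ Y → ∀ R → Y ≡ X ++ R →
                ∃ λ w₃ → w₂ ≡ w₁ ++ w₃ × InH w₃ R
prefix-decode {w₂ = w₂} [] iY R Y≡ = w₂ , refl , subst (InH w₂) Y≡ iY
prefix-decode (_∷_ {A = A} pA iX) [] R Y≡ with block-shape (block-of pA)
... | _ , refl , _ = ⊥-elim (nonempty Y≡)
  where
  nonempty : ∀ {L : List V} → [] ≢ plain e ∷ L
  nonempty ()
prefix-decode (_∷_ {A = A} {W = X′} pA iX) (pB ∷ iY) R Y≡
  with block-prefix-code (block-of pB) (block-of pA) (trans Y≡ (++-assoc A X′ R))
... | refl , refl , Y′≡ with prefix-decode iX iY R Y′≡
...   | w₃ , refl , iR = w₃ , refl , iR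

record Cut (w : List Σ₃) (P Q : List V) : Set where
  field
    w₁ w₂       : List Σ₃
    c           : Σ₃
    W₁ W₂ B₁ B₂ : List V
    word≡       : w ≡ w₁ ++ c ∷ w₂
    left        : InH w₁ W₁
    right       : InH w₂ W₂
    block       : B₁ ++ B₂ ∈ h c
    P≡          : P ≡ W₁ ++ B₁
    Q≡          : Q ≡ B₂ ++ W₂

cut : ∀ {w W} → InH w W → ∀ P Q → W ≡ P ++ Q → Q ≢ [] → Cut w P Q
cut [] P Q W≡ Q≢[] = ⊥-elim (Q≢[] (++-conicalʳ P Q (sym W≡)))
cut (_∷_ {a} {w′} {A} {W′} pA iW) P Q W≡ Q≢[] with ++-split P Q A W′ (sym W≡)
... | inj₁ (P′ , P≡AP′ , W′≡) =
  let open Cut (cut iW P′ Q W′≡ Q≢[]) in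
  record { w₁ = a ∷ w₁ ; w₂ = w₂ ; c = c ; W₁ = A ++ W₁ ; W₂ = W₂ ; B₁ = B₁ ; B₂ = B₂
         ; word≡ = cong (a ∷_) word≡ ; left = pA ∷ left ; right = right ; block = block
         ; P≡ = trans P≡AP′ (trans (cong (A ++_) P≡) (sym (++-assoc A W₁ B₁))) ; Q≡ = Q≡ }
... | inj₂ (B₂ , _ , A≡ , Q≡B₂W′) =
  record { w₁ = [] ; w₂ = w′ ; c = a ; W₁ = [] ; W₂ = W′ ; B₁ = P ; B₂ = B₂
         ; word≡ = refl ; left = [] ; right = iW ; block = subst (_∈ h a) A≡ pA ; P≡ = refl ; Q≡ = Q≡B₂W′ }

cut-at-marker : ∀ {w W} → InH w W → ∀ P Q → W ≡ P ++ plain e ∷ Q →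
                ∃₂ λ w₁ w₂ → w ≡ w₁ ++ w₂ × InH w₁ P × InH w₂ (plain e ∷ Q)
cut-at-marker iW P Q W≡ with cut iW P (plain e ∷ Q) W≡ (λ ())
... | record { w₁ = w₁ ; w₂ = w₂ ; c = c ; W₁ = W₁ ; B₁ = [] ; word≡ = refl ; left = left ; right = right
             ; block = block ; P≡ = refl ; Q≡ = Q≡ } =
  w₁ , c ∷ w₂ , refl , subst (InH w₁) (sym (++-identityʳ W₁)) left , subst (InH _) (sym Q≡) (block ∷ right)
... | record { w₁ = w₁ ; w₂ = w₂ ; c = c ; W₁ = W₁ ; B₁ = B₁@(_ ∷ _) ; B₂ = [] ; word≡ = refl ; left = left
             ; right = right ; block = block ; P≡ = refl ; Q≡ = refl } =
  w₁ ∷ʳ c , w₂ , sym (++-assoc w₁ [ c ] w₂) ,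
  InH-++ left (subst (InH [ c ]) (++-identityʳ B₁) (InH-single block)) , right
... | record { B₁ = B₁@(_ ∷ _) ; B₂ = y ∷ B₂′ ; block = block ; Q≡ = Q≡ } =
  ⊥-elim (marker-only-first {u = B₁} (block-of block) refl (λ ()) (here (proj₁ (∷-injective Q≡))))

last-block : ∀ {w W} → InH w W → ∀ P s → W ≡ P ++ s → s ≢ [] → plain e ∉ s →
             ∃ λ w′ → ∃ λ c → ∃ λ P′ → ∃ λ B₁ →
             w ≡ w′ ∷ʳ c × InH w′ P′ × B₁ ++ s ∈ h c × B₁ ≢ [] × P ≡ P′ ++ B₁
last-block iW P s W≡ s≢[] e∉s with cut iW P s W≡ s≢[]
... | record { W₂ = y ∷ _ ; B₂ = B₂ ; right = right ; Q≡ = Q≡ } =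
  ⊥-elim (e∉s (subst (plain e ∈_) (sym Q≡) (∈-++⁺ʳ B₂ (here (sym (image-begins right refl))))))
... | record { w₁ = w′ ; c = c ; W₁ = P′ ; W₂ = [] ; B₁ = B₁ ; B₂ = B₂ ; word≡ = refl ; left = left
             ; right = right ; block = block ; P≡ = refl ; Q≡ = refl } with image-empty right
...   | refl =
  w′ , c , P′ , B₁ , refl , left , subst (λ S → B₁ ++ S ∈ h c) (sym (++-identityʳ B₂)) block , B₁≢[] , refl
  where
  B₁≢[] : B₁ ≢ []
  B₁≢[] refl with block-shape (block-of block)
  ... | _ , refl , _ = e∉s (here refl)

split-at-first-marker : (x : List V) → plain e ∉ x ⊎ ∃₂ λ y z → x ≡ y ++ plain e ∷ z × plain e ∉ y
split-at-first-marker []      = inj₁ (λ ())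
split-at-first-marker (a ∷ x) with is-marker? a | split-at-first-marker x
... | yes refl | _                        = inj₂ ([] , x , refl , λ ())
... | no e≢a   | inj₁ e∉x                 = inj₁ λ { (here e≡a) → e≢a e≡a ; (there e∈x) → e∉x e∈x }
... | no e≢a   | inj₂ (y , z , refl , e∉y) =
  inj₂ (a ∷ y , z , refl , λ { (here e≡a) → e≢a e≡a ; (there e∈y) → e∉y e∈y })

marker-free-factor : ∀ {w W} → InH w W → ∀ u f v → u ++ f ++ v ≡ W → f ≢ [] → plain e ∉ f →
                     ∃₂ λ a A → Block a A × ∃₂ λ p q → A ≡ p ++ f ++ q
marker-free-factor iW u f v W≡ f≢[] e∉f with cut iW u (f ++ v) (sym W≡) (f≢[] ∘ ++-conicalˡ f v)
... | record { c = c ; W₂ = W₂ ; B₁ = B₁ ; B₂ = B₂ ; right = right ; block = block ; Q≡ = Q≡ }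
  with ++-split f v B₂ W₂ Q≡
...   | inj₂ (z , _ , refl , _)    = c , _ , block-of block , B₁ , z , refl
...   | inj₁ ([] , refl , _)       =
  c , _ , block-of block , B₁ , [] , cong (B₁ ++_) (sym (trans (++-identityʳ (B₂ ++ [])) (++-identityʳ B₂)))
...   | inj₁ (y ∷ z , refl , W₂≡) = ⊥-elim (e∉f (∈-++⁺ʳ B₂ (here (sym (image-begins right W₂≡)))))

-- A square whose root avoids () would lie inside a square-free block.
marker-free-square : ∀ {w W} → InH w W → ∀ u x v → u ++ x ++ x ++ v ≡ W → x ≢ [] → plain e ∉ x → ⊥
marker-free-square iW u x v W≡ x≢[] e∉x
  with marker-free-factor iW u (x ++ x) v (trans (cong (u ++_) (++-assoc x x v)) W≡) (x≢[] ∘ ++-conicalˡ x x) e∉xx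
  where
  e∉xx : plain e ∉ x ++ x
  e∉xx e∈xx = [ e∉x , e∉x ]′ (∈-++⁻ x e∈xx)
... | _ , _ , bA , p , q , refl = block-square-free bA p x q x≢[] (cong (p ++_) (sym (++-assoc x x q)))

-- A nonempty image of t followed by an image of w₃ with the same prefix:
-- w₃ begins with t, so w₁ t w₃ contains the square tt.
aligned-square : ∀ {w₁ t w₃ Z v} → SquareFree (w₁ ++ t ++ w₃) →
                 InH t Z → InH w₃ (Z ++ v) → Z ≢ [] → ⊥
aligned-square {w₁} {t} sf iZ iZv Z≢[] with prefix-decode iZ iZv _ refl
... | w₄ , refl , _ = sf w₁ t w₄ (nonempty-preimage iZ Z≢[]) refl
  where
  nonempty-preimage : ∀ {t Z} → InH t Z → Z ≢ [] → t ≢ []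
  nonempty-preimage []      Z≢[] refl = Z≢[] refl
  nonempty-preimage (_ ∷ _) _    ()

-- Images of w₁ and t ending in the same nonempty ()-free y, followed by an
-- image of w₃ beginning like the image of t: the last blocks of w₁ and t
-- share the suffix y, so by synchronisation w₁ t w₃ contains a square.
misaligned-square : ∀ {w₁ t w₃ U y Z v} → SquareFree (w₁ ++ t ++ w₃) →
                    InH w₁ (U ++ y) → InH t (Z ++ y) → InH w₃ (Z ++ v) → y ≢ [] → plain e ∉ y → ⊥
misaligned-square {U = U} {y} {Z} {v} sf iUy iZy iZv y≢[] e∉y
  with last-block iUy U y refl y≢[] e∉y | last-block iZy Z y refl y≢[] e∉y
... | w₁′ , a , _ , _ , refl , _ , pA , _ , _ | t′ , c , Z₀ , C₁ , refl , iZ₀ , pC , C₁≢[] , refl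
  with prefix-decode iZ₀ iZv (C₁ ++ v) (++-assoc Z₀ C₁ v)
... | w₄ , refl , iC₁v with first-block iC₁v (C₁≢[] ∘ ++-conicalˡ C₁ v)
... | d , w₅ , _ , _ , refl , pD , C₁v≡
  with synchronise (block-of pA) (block-of pC) (block-of pD) refl refl (sym C₁v≡) y≢[]
... | inj₁ refl = sf w₁′ (a ∷ t′) (d ∷ w₅) (λ ())
                     (solve 5 (λ w₁′ a t′ d w₅ → w₁′ ⊕ (a ⊕ t′) ⊕ (a ⊕ t′) ⊕ (d ⊕ w₅)
                                        ⊜ (w₁′ ⊕ a) ⊕ (t′ ⊕ a) ⊕ (t′ ⊕ (d ⊕ w₅)))
                            refl w₁′ [ a ] t′ [ d ] w₅)
... | inj₂ refl = sf (w₁′ ∷ʳ a) (t′ ∷ʳ c) w₅ (∷ʳ≢[] t′ c)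
                     (cong (λ X → (w₁′ ∷ʳ a) ++ (t′ ∷ʳ c) ++ X) (++-assoc t′ [ c ] w₅))

-- A square whose root y Z contains (), first at the start of Z: both copies
-- of Z start at block boundaries, and the two cases y = [] and y ≠ [] are
-- handled by the two lemmas above.
marked-square : ∀ {w W} → SquareFree w → InH w W → ∀ u y z v → plain e ∉ y →
                u ++ (y ++ plain e ∷ z) ++ (y ++ plain e ∷ z) ++ v ≡ W → ⊥
marked-square sf iW u y z v e∉y W≡
  with cut-at-marker iW (u ++ y) (z ++ y ++ plain e ∷ z ++ v) (sym (trans regroup₁ W≡))
  where
  regroup₁ : (u ++ y) ++ plain e ∷ z ++ y ++ plain e ∷ z ++ v ≡ u ++ (y ++ plain e ∷ z) ++ (y ++ plain e ∷ z) ++ v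
  regroup₁ = solve 5 (λ u y E z v → (u ⊕ y) ⊕ E ⊕ z ⊕ y ⊕ E ⊕ z ⊕ v ⊜ u ⊕ (y ⊕ E ⊕ z) ⊕ (y ⊕ E ⊕ z) ⊕ v)
                     refl u y [ plain e ] z v
... | w₁ , w₂ , refl , iUy , iRest
  with cut-at-marker iRest (plain e ∷ z ++ y) (z ++ v) regroup₂
  where
  regroup₂ : plain e ∷ z ++ y ++ plain e ∷ z ++ v ≡ (plain e ∷ z ++ y) ++ plain e ∷ z ++ v
  regroup₂ = solve 4 (λ E z y v → E ⊕ z ⊕ y ⊕ E ⊕ z ⊕ v ⊜ (E ⊕ z ⊕ y) ⊕ E ⊕ z ⊕ v)
                     refl [ plain e ] z y v
... | t , w₃ , refl , iZy , iZv with y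
...   | []    = aligned-square {w₁} {Z = plain e ∷ z} sf (subst (InH t) (++-identityʳ _) iZy) iZv (λ ())
...   | _ ∷ _ = misaligned-square {w₁} {U = u} {Z = plain e ∷ z} {v = v} sf iUy iZy iZv (λ ()) e∉y

-- The linear part of the theorem: split the root of a square at its first ().
h-square-free : ∀ {w W} → SquareFree w → InH w W → SquareFree W
h-square-free sf iW u x v x≢[] W≡ with split-at-first-marker x
... | inj₁ e∉x                 = marker-free-square iW u x v W≡ x≢[] e∉x
... | inj₂ (y , z , refl , e∉y) = marked-square sf iW u y z v e∉y W≡

conjugate-square-free : ∀ {A : Set} {w : List A} → CircSquareFree w →
                        ∀ p q → w ≡ p ++ q → SquareFree (q ++ p)
conjugate-square-free circ p q refl =
  subst SquareFree (rotate-++ p q) (circ (length p) (length-++-≤ˡ p))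

square-ending-like-start : ∀ {A : Set} {c : A} {M} x → x ++ x ≡ c ∷ M ∷ʳ c →
                           M ≡ [] ⊎ ∃ λ y → M ≡ y ++ c ∷ c ∷ y
square-ending-like-start [] ()
square-ending-like-start {c = c} {M} (_ ∷ x′) eq with ∷-injective eq
... | refl , x′cx′≡ with snoc-view x′
...   | inj₁ refl = inj₁ (sym (proj₁ (∷ʳ-injective [] M x′cx′≡)))
...   | inj₂ (y , l , refl) with ∷ʳ-injective (y ++ l ∷ c ∷ y) M (trans regroup x′cx′≡)
  where
  regroup : (y ++ l ∷ c ∷ y) ∷ʳ l ≡ (y ∷ʳ l) ++ c ∷ (y ∷ʳ l)
  regroup = solve 3 (λ y l c → (y ⊕ l ⊕ c ⊕ y) ⊕ l ⊜ (y ⊕ l) ⊕ c ⊕ (y ⊕ l)) refl y [ l ] [ c ]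
...     | M≡ , refl = inj₂ (y , sym M≡)

closed-conjugate-square-free : ∀ {A : Set} {w : List A} → CircSquareFree w → 2 ≤ length w →
                               ∀ w₁ c w₂ → w ≡ w₁ ++ c ∷ w₂ → SquareFree (c ∷ (w₂ ++ w₁) ∷ʳ c)
closed-conjugate-square-free circ 2≤|w| w₁ c w₂ w≡ = square-free-glue sfˡ sfʳ not-square
  where
  sfˡ : SquareFree (c ∷ w₂ ++ w₁)
  sfˡ = conjugate-square-free circ w₁ (c ∷ w₂) w≡
  sfʳ : SquareFree ((w₂ ++ w₁) ∷ʳ c)
  sfʳ = subst SquareFree (sym (++-assoc w₂ w₁ [ c ]))
          (conjugate-square-free circ (w₁ ∷ʳ c) w₂ (trans w≡ (sym (++-assoc w₁ [ c ] w₂))))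
  not-square : ∀ x → x ++ x ≢ c ∷ (w₂ ++ w₁) ∷ʳ c
  not-square x eq with square-ending-like-start x eq
  ... | inj₂ (y , M≡) = sfˡ (c ∷ y) [ c ] y (λ ()) (cong (c ∷_) (sym M≡))
  ... | inj₁ M≡[] = single-letter w₁ w₂ w≡ M≡[] 2≤|w|
    where
    single-letter : ∀ w₁ w₂ {w} → w ≡ w₁ ++ c ∷ w₂ → w₂ ++ w₁ ≡ [] → 2 ≤ length w → ⊥
    single-letter []      []      refl _  (s≤s ())
    single-letter []      (_ ∷ _) _    () _
    single-letter (_ ∷ _) []      _    () _
    single-letter (_ ∷ _) (_ ∷ _) _    () _

circular⇒linear : ∀ {A : Set} {w : List A} → CircSquareFree w → SquareFree w
circular⇒linear {w = w} circ = subst SquareFree (++-identityʳ w) (conjugate-square-free circ [] w refl)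

-- Every conjugate Q P of an image P Q is a factor of an image of c w₂ w₁ c,
-- where the cut P|Q splits a block of c in w = w₁ c w₂.
h-circular-square-free : ∀ {w W} → CircSquareFree w → 2 ≤ length w → InH w W → CircSquareFree W
h-circular-square-free {W = W} circ 2≤|w| iW i _ = conjugate-of-image (take i W) (drop i W) (sym (take++drop≡id i W))
  where
  conjugate-of-image : ∀ P Q → W ≡ P ++ Q → SquareFree (Q ++ P)
  conjugate-of-image P [] W≡ = subst SquareFree (trans W≡ (++-identityʳ P)) (h-square-free (circular⇒linear circ) iW)
  conjugate-of-image P Q@(_ ∷ _) W≡ = square-free-factor closed-image B₁ (Q ++ P) B₂ rearrange
    where
    open Cut (cut iW P Q W≡ (λ ()))
    closed-image : SquareFree ((B₁ ++ B₂) ++ (W₂ ++ W₁) ++ (B₁ ++ B₂))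
    closed-image = h-square-free (closed-conjugate-square-free circ 2≤|w| w₁ c w₂ word≡)
                                 (block ∷ InH-++ (InH-++ right left) (InH-single block))
    rearrange : (B₁ ++ B₂) ++ (W₂ ++ W₁) ++ (B₁ ++ B₂) ≡ B₁ ++ (Q ++ P) ++ B₂
    rearrange = trans (solve 4 (λ b₁ b₂ w₂ w₁ → (b₁ ⊕ b₂) ⊕ (w₂ ⊕ w₁) ⊕ (b₁ ⊕ b₂)
                                              ⊜ b₁ ⊕ ((b₂ ⊕ w₂) ⊕ (w₁ ⊕ b₁)) ⊕ b₂)
                              refl B₁ B₂ W₂ W₁)
                      (cong₂ (λ X Y → B₁ ++ (X ++ Y) ++ B₂) (sym Q≡) (sym P≡))

WalkInto : List V → V → Set
WalkInto []           y = ⊤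
WalkInto (x ∷ [])     y = Arc x y
WalkInto (x ∷ x′ ∷ L) y = Arc x x′ × WalkInto (x′ ∷ L) y

walk-++ : ∀ A {y W z} → WalkInto A y → WalkInto (y ∷ W) z → WalkInto (A ++ y ∷ W) z
walk-++ []           _          walk = walk
walk-++ (_ ∷ [])     arc        walk = arc , walk
walk-++ (_ ∷ x′ ∷ A) (arc , wA) walk = arc , walk-++ (x′ ∷ A) wA walk

block-walk : ∀ {a A} → Block a A → WalkInto A (plain e)
block-walk blk₀  = a01 , a15 , a12 , a05 , a21 , a08
block-walk blk₁  = a01 , a16 , a21 , a07 , a24 , a17
block-walk blk₂  = a01 , a15 , a11 , a19 , a09 , a17
block-walk blk₂′ = a01 , a15 , a11 , a19 , a10 , a04 , a09 , a17

-- Hence so is every image, as the next block starts with ().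
image-walk : ∀ {w W} → InH w W → WalkInto W (plain e)
image-walk []                  = tt
image-walk (_∷_ {A = A} pA iW) with image-shape iW
... | inj₁ (_ , refl)  = subst (λ L → WalkInto L (plain e)) (sym (++-identityʳ A)) (block-walk (block-of pA))
... | inj₂ (_ , refl) = walk-++ A (block-walk (block-of pA)) (image-walk iW)

walk-step : ∀ L {y} → WalkInto L y → (i : Fin (length L)) (i+1<|L| : suc (toℕ i) < length L) →
            Arc (lookup L i) (lookup L (fromℕ< i+1<|L|))
walk-step (_ ∷ [])     _          zero    (s≤s ())
walk-step (_ ∷ _ ∷ _)  (arc , _)  zero    _         = arc
walk-step (_ ∷ x′ ∷ L) (_ , walk) (suc i) (s≤s lt)  = walk-step (x′ ∷ L) walk i lt

walk-last : ∀ L {y} → WalkInto L y → (i : Fin (length L)) → suc (toℕ i) ≡ length L → Arc (lookup L i) y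
walk-last (_ ∷ [])     arc        zero    _  = arc
walk-last (_ ∷ _ ∷ _)  _          zero    ()
walk-last (_ ∷ x′ ∷ L) (_ , walk) (suc i) eq = walk-last (x′ ∷ L) walk i (suc-injective eq)

closed-walk : ∀ x L → WalkInto (x ∷ L) x → Walkable (x ∷ L)
closed-walk x L walk i with m≤n⇒m<n∨m≡n (toℕ<n i)
... | inj₁ lt  = subst (λ j → Arc (lookup (x ∷ L) i) (lookup (x ∷ L) j))
                   (fromℕ<-cong _ _ (sym (m<n⇒m%n≡m lt)) lt (m%n<n (suc (toℕ i)) (suc (length L))))
                   (walk-step (x ∷ L) walk i lt)
... | inj₂ eq = subst (λ j → Arc (lookup (x ∷ L) i) (lookup (x ∷ L) j))
                   (fromℕ<-cong 0 _ (sym (trans (cong (_% suc (length L)) eq) (n%n≡0 (suc (length L)))))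
                                (s≤s z≤n) (m%n<n (suc (toℕ i)) (suc (length L))))
                   (walk-last (x ∷ L) walk i eq)

h-walkable : ∀ {w W} → InH w W → Walkable W
h-walkable iW with image-shape iW
... | inj₁ (_ , refl)  = λ ()
... | inj₂ (W′ , refl) = closed-walk (plain e) W′ (image-walk iW)

lemma11 : (w : List Σ₃) → 2 ≤ length w → CircSquareFree w →
    (W : List V) → InH w W →
    CircSquareFree W × Walkable W
lemma11 w 2≤|w| circ W iW = h-circular-square-free circ 2≤|w| iW , h-walkable iW
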